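{- For any integer $z\ge0$, if an undirected multigraph $G$ has a $z$-antler $(C_1,F_1)$ and an antler $(C_2,F_2)$, then $(C_1\setminus(C_2\cup F_2),\,F_1\setminus(C_2\cup F_2))$ is a $z$-antler in $G-(C_2\cup F_2)$.
   Context: Graphs are undirected multigraphs, possibly with self-loops and parallel edges (these count as cycles). A feedback vertex set (FVS) of $G$ is a set $X\subseteq V(G)$ with $G-X$ acyclic; $\mathrm{fvs}(G)$ is its minimum size. For disjoint vertex sets $X,Y$, $e(X,Y)$ is the number of edges between them. A feedback vertex cut (FVC) in $G$ is a pair of disjoint sets $C,F\subseteq V(G)$ such that $G[F]$ is a forest and every tree $T$ of $G[F]$ satisfies $e(V(T),V(G)\setminus(C\cup F))\le1$. An antler is an FVC $(C,F)$ with $|C|\le\mathrm{fvs}(G[C\cup F])$. For $C\subseteq V(G)$, a $C$-certificate is a subgraph $H$ of $G$ such that $C$ is a minimum FVS of $H$; it has order $z$ if every connected component $H'$ of $H$ satisfies $\mathrm{fvs}(H')=|C\cap V(H')|\le z$. A $z$-antler is an antler $(C,F)$ such that $G[C\cup F]$ contains a $C$-certificate of order $z$. -}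

module Defs where

open import Data.Nat using (ℕ; suc; _≤_)
open import Data.Fin using (Fin; zero; suc; inject₁; fromℕ)
open import Data.Fin.Subset using (Subset; _∈_; _∉_; _⊆_; _∩_; _∪_; ∣_∣; Nonempty)
open import Data.Product using (Σ; ∃; _×_; _,_; proj₁; proj₂)
open import Data.Sum using (_⊎_)
open import Data.Unit using () renaming (⊤ to Unit)
open import Relation.Nullary using (¬_)
open import Relation.Binary.PropositionalEquality using (_≡_)
open import Function using (_∘_)
open import Function.Definitions using (Injective)

-- An undirected multigraph on vertices Fin n with m edges indexed by Fin m;
-- edge e has endpoints ends e (order irrelevant).  Self-loops (a , a) and
-- parallel edges (distinct indices with the same endpoints) are allowed.
record Multigraph : Set where
  field
    n    : ℕ
    m    : ℕ
    ends : Fin m → Fin n × Fin n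
open Multigraph public

module _ (M : Multigraph) where

  -- A graph living inside the ambient multigraph M, given by a vertex set and
  -- an edge set (as predicates).  G itself, G - X, G[S], certificates and their
  -- components are all of this form and keep the vertex/edge names of M.
  record Graph : Set₁ where
    constructor mkGraph
    field
      V : Fin (n M) → Set
      E : Fin (m M) → Set
  open Graph public

  Joins : Fin (m M) → Fin (n M) → Fin (n M) → Set
  Joins e a b = (ends M e ≡ (a , b)) ⊎ (ends M e ≡ (b , a))

  WellFormed : Graph → Set
  WellFormed H = ∀ e a b → E H e → Joins e a b → (V H a × V H b)

  whole : Graph
  whole = mkGraph (λ _ → Unit) (λ _ → Unit)

  inducedP : Graph → (Fin (n M) → Set) → Graph
  inducedP H P = mkGraph (λ v → V H v × P v)
                         (λ e → E H e × P (proj₁ (ends M e)) × P (proj₂ (ends M e)))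

  induced : Graph → Subset (n M) → Graph
  induced H S = inducedP H (_∈ S)

  delete : Graph → Subset (n M) → Graph
  delete H X = inducedP H (_∉ X)

  -- A cycle in H: a closed walk w 0, e 0, w 1, ..., e L, w (L+1) = w 0 of length
  -- L+1 >= 1 with pairwise distinct edges and pairwise distinct vertices
  -- w 0, ..., w L.  (Length 1 = self-loop, length 2 = pair of parallel edges.)
  record Cycle (H : Graph) : Set where
    field
      L      : ℕ
      w      : Fin (suc (suc L)) → Fin (n M)
      e      : Fin (suc L) → Fin (m M)
      closed : w zero ≡ w (fromℕ (suc L))
      step   : ∀ i → Joins (e i) (w (inject₁ i)) (w (suc i))
      e∈     : ∀ i → E H (e i)
      w∈     : ∀ i → V H (w i)
      e-inj  : Injective _≡_ _≡_ e
      w-inj  : Injective _≡_ _≡_ (w ∘ inject₁)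

  Forest : Graph → Set
  Forest H = ¬ Cycle H

  IsFVS : Graph → Subset (n M) → Set
  IsFVS H X = (∀ v → v ∈ X → V H v) × Forest (delete H X)

  IsMinFVS : Graph → Subset (n M) → Set
  IsMinFVS H X = IsFVS H X × (∀ Y → IsFVS H Y → ∣ X ∣ ≤ ∣ Y ∣)

  _≤fvs_ : ℕ → Graph → Set
  k ≤fvs H = ∀ Y → IsFVS H Y → k ≤ ∣ Y ∣

  FvsIs : Graph → ℕ → Set
  FvsIs H k = (∃ λ Y → IsFVS H Y × ∣ Y ∣ ≡ k) × k ≤fvs H

  data Reach (H : Graph) : Fin (n M) → Fin (n M) → Set where
    here : ∀ {u} → V H u → Reach H u u
    step : ∀ {u w v} e → E H e → Joins e u w → Reach H w v → Reach H u v

  IsComponent : Graph → Subset (n M) → Set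
  IsComponent H T =
    Nonempty T
    × (∀ v → v ∈ T → V H v)
    × (∀ u v → u ∈ T → v ∈ T → Reach H u v)
    × (∀ e a b → E H e → Joins e a b → a ∈ T → b ∈ T)

  Between : (Fin (n M) → Set) → (Fin (n M) → Set) → Fin (m M) → Set
  Between X Y e = ∃ λ a → ∃ λ b → Joins e a b × X a × Y b

  AtMostOneEdge : Graph → (Fin (n M) → Set) → (Fin (n M) → Set) → Set
  AtMostOneEdge H X Y = ∀ e₁ e₂ → E H e₁ → E H e₂ →
                        Between X Y e₁ → Between X Y e₂ → e₁ ≡ e₂

  IsFVC : Graph → Subset (n M) → Subset (n M) → Set
  IsFVC H C F =
    (∀ v → v ∈ C → V H v)
    × (∀ v → v ∈ F → V H v)
    × (∀ v → v ∈ C → v ∉ F)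
    × Forest (induced H F)
    × (∀ T → IsComponent (induced H F) T →
         AtMostOneEdge H (_∈ T) (λ v → V H v × v ∉ (C ∪ F)))

  IsAntler : Graph → Subset (n M) → Subset (n M) → Set
  IsAntler H C F = IsFVC H C F × ∣ C ∣ ≤fvs induced H (C ∪ F)

  Subgraph : Graph → Graph → Set
  Subgraph H K = (∀ v → V H v → V K v) × (∀ e → E H e → E K e) × WellFormed H

  HasCertificate : Graph → Subset (n M) → ℕ → Set₁
  HasCertificate K C z =
    Σ Graph λ H → Subgraph H K × IsMinFVS H C
      × (∀ T → IsComponent H T →
           FvsIs (induced H T) ∣ C ∩ T ∣ × ∣ C ∩ T ∣ ≤ z)

  IsZAntler : ℕ → Graph → Subset (n M) → Subset (n M) → Set₁
  IsZAntler z H C F = IsAntler H C F × HasCertificate (induced H (C ∪ F)) C z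

module Submission where

-- The basic fact about a feedback vertex cut (C , F) is that a cycle avoiding C avoids F: a cycle
-- meeting a tree T of G[F] cannot stay inside T, so it leaves T along two distinct edges into
-- V ∖ (C ∪ F).  Hence deleting X = C₂ ∪ F₂ keeps (C₁ ─ X , F₁ ─ X) a feedback vertex cut, and the
-- certificate H of (C₁ , F₁) becomes the certificate H - X.  The counting: if Y is a feedback vertex
-- set of H - X then (Y ∪ C₂) ∩ V(H) is one of H, so ∣C₁∣ ≤ ∣Y∣ + ∣C₂ ∩ (C₁ ∪ F₁)∣; and
-- (C₁ ∩ X) ∪ (C₂ ─ (C₁ ∪ F₁)) is a feedback vertex set of G[X], so by the antler property of (C₂ , F₂)
-- ∣C₂ ∩ (C₁ ∪ F₁)∣ ≤ ∣C₁ ∩ X∣.  Together ∣C₁ ─ X∣ ≤ ∣Y∣.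
--
-- Vertex sets are predicates here, so V(H) and the components of a graph become finite subsets
-- only inside the double-negation monad; each such step ends in a decidable goal.

open import Defs
open import Data.Nat using (ℕ; zero; suc; _+_; _≤_; _≤?_; z≤n; s≤s)
open import Data.Nat.Properties
  using (≤-trans; +-suc; m≤n+m; +-cancelˡ-≤; +-cancelʳ-≤; +-monoʳ-≤; +-comm; module ≤-Reasoning)
open import Data.Vec using ([]; _∷_; here; there)
open import Data.Fin using (Fin; zero; suc; inject₁; fromℕ; _≟_)
open import Data.Fin.Properties using (all?; ¬∀⟶∃¬)
open import Data.Fin.Subset
  using (Subset; inside; outside; _∈_; _∉_; _⊆_; _∪_; _∩_; _─_; ∣_∣)
open import Data.Fin.Subset.Properties
  using (_∈?_; x∈p∪q⁻; x∈p∪q⁺; x∈p∩q⁻; x∈p∩q⁺; x∈p∧x∉q⇒x∈p─q; p─q⊆p; p⊆q⇒∣p∣≤∣q∣)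
open import Data.Product using (Σ-syntax; ∃-syntax; _×_; _,_; proj₁; proj₂; <_,_>)
open import Data.Sum using (_⊎_; inj₁; inj₂; [_,_])
open import Data.Unit using (tt)
open import Data.Empty using (⊥)
open import Effect.Monad using (RawMonad)
open import Function using (_∘_)
open import Level using (0ℓ)
open import Relation.Binary.PropositionalEquality using (_≡_; refl; sym; trans; cong; subst)
open import Relation.Nullary using (¬_; Dec; yes; no; ¬?)
open import Relation.Nullary.Decidable using (decidable-stable; ¬¬-excluded-middle)
open import Relation.Nullary.Negation using (¬¬-Monad; contradiction)
open import Relation.Unary using (Pred; Decidable; _≐_)

open RawMonad (¬¬-Monad {0ℓ}) using (pure; _>>=_)

private variable
  k : ℕ
  x : Fin k
  p q r : Subset k

x∈p─q⇒x∉q : ∀ (p q : Subset k) → x ∈ p ─ q → x ∉ q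
x∈p─q⇒x∉q (inside ∷ p) (outside ∷ q) here ()
x∈p─q⇒x∉q (_ ∷ p) (_ ∷ q) (there x∈p─q) (there x∈q) = x∈p─q⇒x∉q p q x∈p─q x∈q

x∉p∧x∉q⇒x∉p∪q : x ∉ p → x ∉ q → x ∉ p ∪ q
x∉p∧x∉q⇒x∉p∪q x∉p x∉q = [ x∉p , x∉q ] ∘ x∈p∪q⁻ _ _

x∈p∪q∧x∉r⇒x∈p─r∪q─r : x ∈ p ∪ q → x ∉ r → x ∈ (p ─ r) ∪ (q ─ r)
x∈p∪q∧x∉r⇒x∈p─r∪q─r x∈p∪q x∉r with x∈p∪q⁻ _ _ x∈p∪q
... | inj₁ x∈p = x∈p∪q⁺ (inj₁ (x∈p∧x∉q⇒x∈p─q x∈p x∉r))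
... | inj₂ x∈q = x∈p∪q⁺ (inj₂ (x∈p∧x∉q⇒x∈p─q x∈q x∉r))

∣p∪q∣≤∣p∣+∣q∣ : ∀ (p q : Subset k) → ∣ p ∪ q ∣ ≤ ∣ p ∣ + ∣ q ∣
∣p∪q∣≤∣p∣+∣q∣ [] [] = z≤n
∣p∪q∣≤∣p∣+∣q∣ (outside ∷ p) (outside ∷ q) = ∣p∪q∣≤∣p∣+∣q∣ p q
∣p∪q∣≤∣p∣+∣q∣ (inside ∷ p) (outside ∷ q) = s≤s (∣p∪q∣≤∣p∣+∣q∣ p q)
∣p∪q∣≤∣p∣+∣q∣ (outside ∷ p) (inside ∷ q) =
  subst (suc ∣ p ∪ q ∣ ≤_) (sym (+-suc ∣ p ∣ ∣ q ∣)) (s≤s (∣p∪q∣≤∣p∣+∣q∣ p q))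
∣p∪q∣≤∣p∣+∣q∣ (inside ∷ p) (inside ∷ q) =
  s≤s (≤-trans (∣p∪q∣≤∣p∣+∣q∣ p q) (subst (∣ p ∣ + ∣ q ∣ ≤_) (sym (+-suc ∣ p ∣ ∣ q ∣)) (m≤n+m _ 1)))

∣p∣≡∣p∩q∣+∣p─q∣ : ∀ (p q : Subset k) → ∣ p ∣ ≡ ∣ p ∩ q ∣ + ∣ p ─ q ∣
∣p∣≡∣p∩q∣+∣p─q∣ [] [] = refl
∣p∣≡∣p∩q∣+∣p─q∣ (outside ∷ p) (outside ∷ q) = ∣p∣≡∣p∩q∣+∣p─q∣ p q
∣p∣≡∣p∩q∣+∣p─q∣ (outside ∷ p) (inside ∷ q) = ∣p∣≡∣p∩q∣+∣p─q∣ p q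
∣p∣≡∣p∩q∣+∣p─q∣ (inside ∷ p) (inside ∷ q) = cong suc (∣p∣≡∣p∩q∣+∣p─q∣ p q)
∣p∣≡∣p∩q∣+∣p─q∣ (inside ∷ p) (outside ∷ q) =
  trans (cong suc (∣p∣≡∣p∩q∣+∣p─q∣ p q)) (sym (+-suc ∣ p ∩ q ∣ ∣ p ─ q ∣))

¬¬-subset : (P : Pred (Fin k) 0ℓ) → ¬ ¬ (Σ[ S ∈ Subset k ] (_∈ S) ≐ P)
¬¬-subset {zero} P = pure ([] , (λ ()) , λ { {()} })
¬¬-subset {suc k} P = do
  P₀? ← ¬¬-excluded-middle
  S , S⊆P , P⊆S ← ¬¬-subset (P ∘ suc)
  pure (cons P₀? S S⊆P P⊆S)
  where
  cons : Dec (P zero) → (S : Subset k) → (∀ {x} → x ∈ S → P (suc x)) → (∀ {x} → P (suc x) → x ∈ S) →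
         Σ[ S′ ∈ Subset (suc k) ] (_∈ S′) ≐ P
  cons (yes p₀) S S⊆P P⊆S =
    inside ∷ S , (λ { here → p₀ ; (there x∈S) → S⊆P x∈S }) ,
    λ { {zero} _ → here ; {suc _} p → there (P⊆S p) }
  cons (no ¬p₀) S S⊆P P⊆S =
    outside ∷ S , (λ { (there x∈S) → S⊆P x∈S }) ,
    λ { {zero} p → contradiction p ¬p₀ ; {suc _} p → there (P⊆S p) }

leaves : {P : Pred (Fin (suc k)) 0ℓ} → Decidable P → ∀ {b} → P zero → ¬ P b →
         ∃[ i ] P (inject₁ i) × ¬ P (suc i)
leaves {k} P? {zero} p₀ ¬p₀ = contradiction p₀ ¬p₀
leaves {suc k} P? {suc b} p₀ ¬pb with P? (suc zero)
... | no ¬p₁ = zero , p₀ , ¬p₁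
... | yes p₁ = let i , pi , ¬pi = leaves (P? ∘ suc) p₁ ¬pb in suc i , pi , ¬pi

enters : {P : Pred (Fin (suc k)) 0ℓ} → Decidable P → ∀ {b} → ¬ P b → P (fromℕ k) →
         ∃[ i ] ¬ P (inject₁ i) × P (suc i)
enters {zero} P? {zero} ¬p₀ p₀ = contradiction p₀ ¬p₀
enters {suc k} P? {zero} ¬p₀ pl with P? (suc zero)
... | yes p₁ = zero , ¬p₀ , p₁
... | no ¬p₁ = let i , ¬pi , pi = enters (P? ∘ suc) ¬p₁ pl in suc i , ¬pi , pi
enters {suc k} P? {suc b} ¬pb pl = let i , ¬pi , pi = enters (P? ∘ suc) ¬pb pl in suc i , ¬pi , pi

crosses : {P : Pred (Fin (suc k)) 0ℓ} → Decidable P →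
          (P zero → P (fromℕ k)) → (P (fromℕ k) → P zero) → ∀ {a b} → P a → ¬ P b →
          (∃[ i ] P (inject₁ i) × ¬ P (suc i)) × (∃[ i ] ¬ P (inject₁ i) × P (suc i))
crosses P? first⇒last last⇒first pa ¬pb with P? zero
... | yes p₀ = leaves P? p₀ ¬pb , enters P? ¬pb (first⇒last p₀)
... | no ¬p₀ =
  -- P fails at both ends, so the exits of P are the entries of ¬ P and vice versa
  let i , ¬¬pi , ¬pi = enters (¬? ∘ P?) (λ ¬pa → ¬pa pa) (¬p₀ ∘ last⇒first)
      j , ¬pj , ¬¬pj = leaves (¬? ∘ P?) ¬p₀ (λ ¬pa → ¬pa pa)
  in (i , decidable-stable (P? _) ¬¬pi , ¬pi) , (j , ¬pj , decidable-stable (P? _) ¬¬pj)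

module _ {M : Multigraph} where

  private variable
    H K : Graph M
    P : Pred (Fin (n M)) 0ℓ
    C F X Y : Subset (n M)
    u v t : Fin (n M)
    d : Fin (m M)

  joins-sym : ∀ {a b} → Joins M d a b → Joins M d b a
  joins-sym (inj₁ eq) = inj₂ eq
  joins-sym (inj₂ eq) = inj₁ eq

  joins⇒ends : ∀ {a b} → Joins M d a b → P a → P b →
               P (proj₁ (ends M d)) × P (proj₂ (ends M d))
  joins⇒ends (inj₁ refl) pa pb = pa , pb
  joins⇒ends (inj₂ refl) pa pb = pb , pa

  ends⇒joins : ∀ {a b} → Joins M d a b → P (proj₁ (ends M d)) → P (proj₂ (ends M d)) → P a × P b
  ends⇒joins (inj₁ refl) p₁ p₂ = p₁ , p₂
  ends⇒joins (inj₂ refl) p₁ p₂ = p₂ , p₁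

  whole-wellFormed : WellFormed M (whole M)
  whole-wellFormed _ _ _ _ _ = tt , tt

  inducedP-wellFormed : WellFormed M H → WellFormed M (inducedP M H P)
  inducedP-wellFormed {P = P} wf e a b (e∈H , p₁ , p₂) j =
    let a∈H , b∈H = wf e a b e∈H j
        pa , pb = ends⇒joins {P = P} j p₁ p₂
    in (a∈H , pa) , (b∈H , pb)

  weaken : (∀ v → V H v → V K v) → (∀ e → E H e → E K e) → Cycle M H → Cycle M K
  weaken V⊆ E⊆ Z = record
    { L = Z.L ; w = Z.w ; e = Z.e ; closed = Z.closed ; step = Z.step ; e-inj = Z.e-inj ; w-inj = Z.w-inj
    ; e∈ = λ i → E⊆ (Z.e i) (Z.e∈ i) ; w∈ = λ j → V⊆ (Z.w j) (Z.w∈ j) }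
    where module Z = Cycle Z

  weaken-delete : Subgraph M H K → Cycle M (delete M H Y) → Cycle M (delete M K Y)
  weaken-delete (V⊆ , E⊆ , _) =
    weaken (λ v (v∈H , v∉Y) → V⊆ v v∈H , v∉Y) (λ d (d∈H , ∉Y) → E⊆ d d∈H , ∉Y)

  module _ (P : Pred (Fin (n M)) 0ℓ) (Z : Cycle M H) where
    open Cycle Z using (w)

    AllVertices Meets Exits Enters : Set
    AllVertices = ∀ j → P (w j)
    Meets = ∃[ j ] P (w j)
    Exits = ∃[ i ] P (w (inject₁ i)) × ¬ P (w (suc i))
    Enters = ∃[ i ] ¬ P (w (inject₁ i)) × P (w (suc i))

  restrict : (Z : Cycle M H) → AllVertices P Z → Cycle M (inducedP M H P)
  restrict {P = P} Z p = record
    { L = Z.L ; w = Z.w ; e = Z.e ; closed = Z.closed ; step = Z.step ; e-inj = Z.e-inj ; w-inj = Z.w-inj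
    ; e∈ = λ i → Z.e∈ i , joins⇒ends {P = P} (Z.step i) (p (inject₁ i)) (p (suc i))
    ; w∈ = λ j → Z.w∈ j , p j }
    where module Z = Cycle Z

  inside-or-crosses : (Z : Cycle M H) → Decidable P → Meets P Z →
                      AllVertices P Z ⊎ Exits P Z × Enters P Z
  inside-or-crosses {P = P} Z P? (a , pa) with all? (P? ∘ Cycle.w Z)
  ... | yes all = inj₁ all
  ... | no ¬all =
    let b , ¬pb = ¬∀⟶∃¬ _ _ (P? ∘ Cycle.w Z) ¬all
    in inj₂ (crosses (P? ∘ Cycle.w Z) (subst P (Cycle.closed Z)) (subst P (sym (Cycle.closed Z)))
                     pa ¬pb)

  reach-target : Reach M K u v → V K v
  reach-target (here v∈K) = v∈K
  reach-target (step _ _ _ r) = reach-target r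

  reach-trans : Reach M K u v → Reach M K v t → Reach M K u t
  reach-trans (here _) r′ = r′
  reach-trans (step e e∈K j r) r′ = step e e∈K j (reach-trans r r′)

  reach-sym : WellFormed M K → V K u → Reach M K u v → Reach M K v u
  reach-sym wf u∈K (here v∈K) = here v∈K
  reach-sym wf u∈K (step e e∈K j r) =
    reach-trans (reach-sym wf (proj₂ (wf e _ _ e∈K j)) r) (step e e∈K (joins-sym j) (here u∈K))

  reach-map : (∀ v → V H v → V K v) → (∀ e → E H e → E K e) → Reach M H u v → Reach M K u v
  reach-map V⊆ E⊆ (here v∈H) = here (V⊆ _ v∈H)
  reach-map V⊆ E⊆ (step e e∈H j r) = step e (E⊆ e e∈H) j (reach-map V⊆ E⊆ r)

  component-of : WellFormed M K → V K t →
    ¬ ¬ (Σ[ T ∈ Subset (n M) ] IsComponent M K T × (∀ {v} → Reach M K t v → v ∈ T))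
  component-of {K = K} {t = t} wf t∈K = do
    T , T⊆R , R⊆T ← ¬¬-subset (Reach M K t)
    let connected : ∀ u v → u ∈ T → v ∈ T → Reach M K u v
        connected u v u∈T v∈T = reach-trans (reach-sym wf t∈K (T⊆R u∈T)) (T⊆R v∈T)
        closed : ∀ d a b → E K d → Joins M d a b → a ∈ T → b ∈ T
        closed d a b d∈K j a∈T =
          R⊆T (reach-trans (T⊆R a∈T) (step d d∈K j (here (proj₂ (wf d a b d∈K j)))))
    pure (T , ((t , R⊆T (here t∈K)) , (λ v → reach-target ∘ T⊆R) , connected , closed) , λ {_} → R⊆T)

  component-⊆-component : (∀ v → V H v → V K v) → (∀ d → E H d → E K d) → WellFormed M K →
    ∀ {T} → IsComponent M H T → ¬ ¬ (Σ[ T̂ ∈ Subset (n M) ] IsComponent M K T̂ × T ⊆ T̂)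
  component-⊆-component V⊆ E⊆ wfK ((t , t∈T) , T⊆H , connected , _) = do
    T̂ , T̂-component , reach⊆T̂ ← component-of wfK (V⊆ t (T⊆H t t∈T))
    pure (T̂ , T̂-component , λ {_} v∈T → reach⊆T̂ (reach-map V⊆ E⊆ (connected _ _ t∈T v∈T)))

  cycle-within-component : ∀ {T} → IsComponent M K T → (Z : Cycle M K) →
    Meets (_∈ T) Z → AllVertices (_∈ T) Z
  cycle-within-component {T = T} (_ , _ , _ , closed) Z meets
    with inside-or-crosses Z (_∈? T) meets
  ... | inj₁ within = within
  ... | inj₂ ((i , in-T , out-T) , _) =
    contradiction (closed (Cycle.e Z i) _ _ (Cycle.e∈ Z i) (Cycle.step Z i) in-T) out-T

  cycle-avoiding-C-avoids-F : IsFVC M (whole M) C F → (Z : Cycle M H) →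
    AllVertices (_∉ C) Z → AllVertices (_∉ F) Z
  cycle-avoiding-C-avoids-F {C = C} {F = F} (_ , _ , _ , forest , one-edge) Z ∉C a w∈F =
    component-of (inducedP-wellFormed whole-wellFormed) (tt , w∈F) λ (T , T-component , reach⊆T) →
      [ contained T T-component , crossing T T-component ]
        (inside-or-crosses Z (_∈? T) (a , reach⊆T (here (tt , w∈F))))
    where
    open Cycle Z using (w; e; e-inj) renaming (step to joins)
    Z-in-G : Cycle M (whole M)
    Z-in-G = weaken (λ _ _ → tt) (λ _ _ → tt) Z

    contained : ∀ T → IsComponent M (induced M (whole M) F) T → ¬ AllVertices (_∈ T) Z
    contained T (_ , T⊆F , _) within = forest (restrict Z-in-G λ j → proj₂ (T⊆F _ (within j)))

    -- an edge leaving T cannot end in F (it would lie in G[F]), and by hypothesis not in C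
    leaving : ∀ T → IsComponent M (induced M (whole M) F) T → ∀ {a b} → Joins M d a b →
              a ∈ T → b ∉ T → b ∉ C → Between M (_∈ T) (λ v → V (whole M) v × v ∉ C ∪ F) d
    leaving T (_ , T⊆F , _ , closed) {a} {b} j a∈T b∉T b∉C =
      a , b , j , a∈T , tt , x∉p∧x∉q⇒x∉p∪q b∉C λ b∈F →
        b∉T (closed _ a b (tt , joins⇒ends {P = _∈ F} j (proj₂ (T⊆F a a∈T)) b∈F) j a∈T)

    crossing : ∀ T → IsComponent M (induced M (whole M) F) T → ¬ (Exits (_∈ T) Z × Enters (_∈ T) Z)
    crossing T T-component ((i , wi∈T , wi+1∉T) , (i′ , wi′∉T , wi′+1∈T)) =
      wi+1∉T (subst (λ i → w (suc i) ∈ T) (sym same-edge) wi′+1∈T)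
      where
      same-edge : i ≡ i′
      same-edge = e-inj (one-edge T T-component (e i) (e i′) tt tt
        (leaving T T-component (joins i) wi∈T wi+1∉T (∉C (suc i)))
        (leaving T T-component (joins-sym (joins i′)) wi′+1∈T wi′∉T (∉C (inject₁ i′))))

  fvs-inducedP : ∀ {S} → IsFVS M H C → (∀ {v} → v ∈ S → v ∈ C × P v) →
                 (∀ {v} → P v → v ∈ C → v ∈ S) → IsFVS M (inducedP M H P) S
  fvs-inducedP {C = C} {P = P} (C⊆H , acyclic) S⊆C∩P C∩P⊆S =
    (λ v v∈S → let v∈C , pv = S⊆C∩P v∈S in C⊆H v v∈C , pv) ,
    λ Z → acyclic (restrict (weaken (λ _ → proj₁ ∘ proj₁) (λ _ → proj₁ ∘ proj₁) Z)
                            λ j w∈C → proj₂ (Cycle.w∈ Z j) (C∩P⊆S (proj₂ (proj₁ (Cycle.w∈ Z j))) w∈C))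

  fvs-delete : IsFVS M H C → IsFVS M (delete M H X) (C ─ X)
  fvs-delete {C = C} {X = X} C-fvs =
    fvs-inducedP C-fvs < p─q⊆p C X , x∈p─q⇒x∉q C X > λ v∉X v∈C → x∈p∧x∉q⇒x∈p─q v∈C v∉X

  min-fvs-component : ∀ {T} → IsMinFVS M K C → IsComponent M K T → FvsIs M (induced M K T) ∣ C ∩ T ∣
  min-fvs-component {K = K} {C = C} {T = T} (C-fvs , minimal) T-component =
    (C ∩ T , fvs-inducedP C-fvs (x∈p∩q⁻ C T) (λ v∈T v∈C → x∈p∩q⁺ (v∈C , v∈T)) , refl) , lower
    where
    lower : _≤fvs_ M ∣ C ∩ T ∣ (induced M K T)
    lower Y (Y⊆K[T] , acyclic) = +-cancelʳ-≤ ∣ C ─ T ∣ _ _ (begin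
      ∣ C ∩ T ∣ + ∣ C ─ T ∣  ≡⟨ ∣p∣≡∣p∩q∣+∣p─q∣ C T ⟨
      ∣ C ∣                 ≤⟨ minimal (Y ∪ (C ─ T)) extended ⟩
      ∣ Y ∪ (C ─ T) ∣       ≤⟨ ∣p∪q∣≤∣p∣+∣q∣ Y (C ─ T) ⟩
      ∣ Y ∣ + ∣ C ─ T ∣      ∎)
      where
      open ≤-Reasoning
      -- a cycle of K meeting T lies in K[T] - Y; otherwise it avoids T and hence C
      extended : IsFVS M K (Y ∪ (C ─ T))
      extended =
        (λ v v∈Y∪ → [ proj₁ ∘ Y⊆K[T] v , proj₁ C-fvs v ∘ p─q⊆p C T ] (x∈p∪q⁻ Y (C ─ T) v∈Y∪)) , no-cycle
        where
        no-cycle : Forest M (delete M K (Y ∪ (C ─ T)))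
        no-cycle Z = by-cases (Cycle.w Z zero ∈? T)
          where
          Z-in-K : Cycle M K
          Z-in-K = weaken (λ _ → proj₁) (λ _ → proj₁) Z
          ∉Y∪ : AllVertices (_∉ Y ∪ (C ─ T)) Z
          ∉Y∪ j = proj₂ (Cycle.w∈ Z j)
          by-cases : Dec (Cycle.w Z zero ∈ T) → ⊥
          by-cases (yes w₀∈T) =
            acyclic (restrict (restrict Z-in-K (cycle-within-component T-component Z-in-K (zero , w₀∈T)))
                              λ j → ∉Y∪ j ∘ x∈p∪q⁺ ∘ inj₁)
          by-cases (no w₀∉T) = proj₂ C-fvs (restrict Z-in-K λ j w∈C →
            ∉Y∪ j (x∈p∪q⁺ (inj₂ (x∈p∧x∉q⇒x∈p─q w∈C λ w∈T →
              w₀∉T (cycle-within-component T-component Z-in-K (j , w∈T) zero)))))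

  fvc-delete : IsFVC M (whole M) C F → IsFVC M (delete M (whole M) X) (C ─ X) (F ─ X)
  fvc-delete {C = C} {F = F} {X = X} (_ , _ , disjoint , forest , one-edge) =
    (λ v v∈C─X → tt , x∈p─q⇒x∉q C X v∈C─X) ,
    (λ v v∈F─X → tt , x∈p─q⇒x∉q F X v∈F─X) ,
    (λ v v∈C─X v∈F─X → disjoint v (p─q⊆p C X v∈C─X) (p─q⊆p F X v∈F─X)) ,
    (λ Z → forest (restrict (weaken (λ _ _ → tt) (λ _ _ → tt) Z)
                            λ j → p─q⊆p F X (proj₂ (Cycle.w∈ Z j)))) ,
    one-edge′
    where
    G-X = delete M (whole M) X

    E⊆ : ∀ d → E (induced M G-X (F ─ X)) d → E (induced M (whole M) F) d
    E⊆ d (_ , f₁ , f₂) = tt , p─q⊆p F X f₁ , p─q⊆p F X f₂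

    -- each component of (G - X)[F ─ X] lies in a component of G[F], whose leaving edges it inherits
    one-edge′ : ∀ T → IsComponent M (induced M G-X (F ─ X)) T →
      AtMostOneEdge M G-X (_∈ T) (λ v → V G-X v × v ∉ (C ─ X) ∪ (F ─ X))
    one-edge′ T T-component d₁ d₂ _ _ B₁ B₂ = decidable-stable (d₁ ≟ d₂) do
      T̂ , T̂-component , T⊆T̂ ← component-⊆-component (λ v (_ , v∈F─X) → tt , p─q⊆p F X v∈F─X)
                                 E⊆ (inducedP-wellFormed whole-wellFormed) T-component
      let widen : ∀ {d} → Between M (_∈ T) (λ v → V G-X v × v ∉ (C ─ X) ∪ (F ─ X)) d →
                          Between M (_∈ T̂) (λ v → V (whole M) v × v ∉ C ∪ F) d
          widen (a , b , j , a∈T , (_ , b∉X) , b∉) =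
            a , b , j , T⊆T̂ a∈T , tt , λ b∈C∪F → b∉ (x∈p∪q∧x∉r⇒x∈p─r∪q─r b∈C∪F b∉X)
      pure (one-edge T̂ T̂-component d₁ d₂ tt tt (widen B₁) (widen B₂))

  antler-overlap : ∀ {C₁ F₁ C₂ F₂} → IsFVC M (whole M) C₁ F₁ → IsAntler M (whole M) C₂ F₂ →
                   ∣ C₂ ∩ (C₁ ∪ F₁) ∣ ≤ ∣ C₁ ∩ (C₂ ∪ F₂) ∣
  antler-overlap {C₁} {F₁} {C₂} {F₂} fvc₁ (fvc₂ , small₂) = +-cancelʳ-≤ ∣ C₂ ─ (C₁ ∪ F₁) ∣ _ _ (begin
    ∣ C₂ ∩ (C₁ ∪ F₁) ∣ + ∣ C₂ ─ (C₁ ∪ F₁) ∣  ≡⟨ ∣p∣≡∣p∩q∣+∣p─q∣ C₂ (C₁ ∪ F₁) ⟨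
    ∣ C₂ ∣                                ≤⟨ small₂ S (S⊆X , acyclic) ⟩
    ∣ S ∣                                 ≤⟨ ∣p∪q∣≤∣p∣+∣q∣ (C₁ ∩ (C₂ ∪ F₂)) (C₂ ─ (C₁ ∪ F₁)) ⟩
    ∣ C₁ ∩ (C₂ ∪ F₂) ∣ + ∣ C₂ ─ (C₁ ∪ F₁) ∣  ∎)
    where
    open ≤-Reasoning
    S = (C₁ ∩ (C₂ ∪ F₂)) ∪ (C₂ ─ (C₁ ∪ F₁))
    S⊆X : ∀ v → v ∈ S → V (induced M (whole M) (C₂ ∪ F₂)) v
    S⊆X v v∈S = tt , [ proj₂ ∘ x∈p∩q⁻ C₁ _ , x∈p∪q⁺ ∘ inj₁ ∘ p─q⊆p C₂ _ ] (x∈p∪q⁻ _ _ v∈S)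
    acyclic : Forest M (delete M (induced M (whole M) (C₂ ∪ F₂)) S)
    acyclic Z = [ ∉C₂ zero , ∉F₂ zero ] (x∈p∪q⁻ C₂ F₂ (in-X zero))
      where
      in-X : AllVertices (_∈ C₂ ∪ F₂) Z
      in-X j = proj₂ (proj₁ (Cycle.w∈ Z j))
      ∉S : AllVertices (_∉ S) Z
      ∉S j = proj₂ (Cycle.w∈ Z j)
      ∉C₁ : AllVertices (_∉ C₁) Z
      ∉C₁ j w∈C₁ = ∉S j (x∈p∪q⁺ (inj₁ (x∈p∩q⁺ (w∈C₁ , in-X j))))
      ∉F₁ = cycle-avoiding-C-avoids-F fvc₁ Z ∉C₁
      ∉C₂ : AllVertices (_∉ C₂) Z
      ∉C₂ j w∈C₂ = ∉S j (x∈p∪q⁺ (inj₂ (x∈p∧x∉q⇒x∈p─q w∈C₂ (x∉p∧x∉q⇒x∉p∪q (∉C₁ j) (∉F₁ j)))))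
      ∉F₂ = cycle-avoiding-C-avoids-F fvc₂ Z ∉C₂

  fvs-extend-over-fvc : ∀ {D} → IsFVC M (whole M) C F → (_∈ D) ≐ V H →
    Forest M (delete M (delete M H (C ∪ F)) Y) → IsFVS M H ((Y ∪ C) ∩ D)
  fvs-extend-over-fvc {C = C} {F = F} {Y = Y} {D = D} fvc (D⊆H , H⊆D) acyclic =
    (λ v → D⊆H ∘ proj₂ ∘ x∈p∩q⁻ _ D) ,
    λ Z → let ∉S : ∀ j → Cycle.w Z j ∉ (Y ∪ C) ∩ D
              ∉S j = proj₂ (Cycle.w∈ Z j)
              ∉Y∪C : AllVertices (_∉ Y ∪ C) Z
              ∉Y∪C j w∈Y∪C = ∉S j (x∈p∩q⁺ (w∈Y∪C , H⊆D (proj₁ (Cycle.w∈ Z j))))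
              ∉C = λ j → ∉Y∪C j ∘ x∈p∪q⁺ ∘ inj₂
              ∉F = cycle-avoiding-C-avoids-F fvc Z ∉C
          in acyclic (restrict (restrict (weaken (λ _ → proj₁) (λ _ → proj₁) Z)
                                         λ j → x∉p∧x∉q⇒x∉p∪q (∉C j) (∉F j))
                               λ j → ∉Y∪C j ∘ x∈p∪q⁺ ∘ inj₁)

  certificate-fvs-bound : ∀ {C₁ F₁ C₂ F₂} → IsFVC M (whole M) C₁ F₁ → IsAntler M (whole M) C₂ F₂ →
    (∀ v → V H v → v ∈ C₁ ∪ F₁) → IsMinFVS M H C₁ →
    Forest M (delete M (delete M H (C₂ ∪ F₂)) Y) → ∣ C₁ ─ (C₂ ∪ F₂) ∣ ≤ ∣ Y ∣
  certificate-fvs-bound {H = H} {Y = Y} {C₁} {F₁} {C₂} {F₂}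
                        fvc₁ antler₂@(fvc₂ , _) H⊆C₁∪F₁ (_ , minimal) acyclic =
    decidable-stable (_ ≤? _) do
      D , D≐H ← ¬¬-subset (V H)
      let S⊆ : (Y ∪ C₂) ∩ D ⊆ Y ∪ (C₂ ∩ (C₁ ∪ F₁))
          S⊆ v∈S = let v∈Y∪C₂ , v∈D = x∈p∩q⁻ _ D v∈S in
            [ x∈p∪q⁺ ∘ inj₁ , (λ v∈C₂ → x∈p∪q⁺ (inj₂ (x∈p∩q⁺ (v∈C₂ , H⊆C₁∪F₁ _ (proj₁ D≐H v∈D))))) ]
              (x∈p∪q⁻ Y C₂ v∈Y∪C₂)
      pure (+-cancelˡ-≤ ∣ C₁ ∩ (C₂ ∪ F₂) ∣ _ _ (begin
        ∣ C₁ ∩ (C₂ ∪ F₂) ∣ + ∣ C₁ ─ (C₂ ∪ F₂) ∣  ≡⟨ ∣p∣≡∣p∩q∣+∣p─q∣ C₁ (C₂ ∪ F₂) ⟨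
        ∣ C₁ ∣                               ≤⟨ minimal _ (fvs-extend-over-fvc fvc₂ D≐H acyclic) ⟩
        ∣ (Y ∪ C₂) ∩ D ∣                     ≤⟨ p⊆q⇒∣p∣≤∣q∣ S⊆ ⟩
        ∣ Y ∪ (C₂ ∩ (C₁ ∪ F₁)) ∣              ≤⟨ ∣p∪q∣≤∣p∣+∣q∣ Y _ ⟩
        ∣ Y ∣ + ∣ C₂ ∩ (C₁ ∪ F₁) ∣            ≤⟨ +-monoʳ-≤ ∣ Y ∣ (antler-overlap fvc₁ antler₂) ⟩
        ∣ Y ∣ + ∣ C₁ ∩ (C₂ ∪ F₂) ∣            ≡⟨ +-comm ∣ Y ∣ _ ⟩
        ∣ C₁ ∩ (C₂ ∪ F₂) ∣ + ∣ Y ∣            ∎))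
    where open ≤-Reasoning

  certificate-delete : Subgraph M H (induced M (whole M) (C ∪ F)) →
    Subgraph M (delete M H X) (induced M (delete M (whole M) X) ((C ─ X) ∪ (F ─ X)))
  certificate-delete (H⊆ , E⊆ , wf) =
    (λ v (v∈H , v∉X) → (tt , v∉X) , x∈p∪q∧x∉r⇒x∈p─r∪q─r (proj₂ (H⊆ v v∈H)) v∉X) ,
    (λ d (d∈H , x₁ , x₂) → let _ , c₁ , c₂ = E⊆ d d∈H in
      (tt , x₁ , x₂) , x∈p∪q∧x∉r⇒x∈p─r∪q─r c₁ x₁ , x∈p∪q∧x∉r⇒x∈p─r∪q─r c₂ x₂) ,
    inducedP-wellFormed wf

  order-delete : ∀ {z T} → WellFormed M H → (∀ T → IsComponent M H T → ∣ C ∩ T ∣ ≤ z) →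
    IsComponent M (delete M H X) T → ∣ (C ─ X) ∩ T ∣ ≤ z
  order-delete {C = C} {X = X} {z = z} {T = T} wf order T-component = decidable-stable (_ ≤? z) do
    T̂ , T̂-component , T⊆T̂ ← component-⊆-component (λ _ → proj₁) (λ _ → proj₁) wf T-component
    let ⊆C∩T̂ : (C ─ X) ∩ T ⊆ C ∩ T̂
        ⊆C∩T̂ v∈ = let v∈C─X , v∈T = x∈p∩q⁻ (C ─ X) T v∈ in x∈p∩q⁺ (p─q⊆p C X v∈C─X , T⊆T̂ v∈T)
    pure (≤-trans (p⊆q⇒∣p∣≤∣q∣ ⊆C∩T̂) (order T̂ T̂-component))

lemma10 : (z : ℕ) (M : Multigraph) (C₁ F₁ C₂ F₂ : Subset (n M)) →
  IsZAntler M z (whole M) C₁ F₁ →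
  IsAntler M (whole M) C₂ F₂ →
  IsZAntler M z (delete M (whole M) (C₂ ∪ F₂)) (C₁ ─ (C₂ ∪ F₂)) (F₁ ─ (C₂ ∪ F₂))
lemma10 z M C₁ F₁ C₂ F₂ ((fvc₁ , _) , H , H⊆@(V⊆ , _ , wfH) , (C₁-fvs , minimal) , components) antler₂ =
  (fvc-delete fvc₁ , small) , delete M H X , certificate-delete H⊆ , minimal′ , λ T T-component →
    min-fvs-component minimal′ T-component ,
    order-delete {C = C₁} wfH (λ T → proj₂ ∘ components T) T-component
  where
  X = C₂ ∪ F₂

  bound : ∀ Y → Forest M (delete M (delete M H X) Y) → ∣ C₁ ─ X ∣ ≤ ∣ Y ∣
  bound Y = certificate-fvs-bound fvc₁ antler₂ (λ v → proj₂ ∘ V⊆ v) (C₁-fvs , minimal)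

  minimal′ : IsMinFVS M (delete M H X) (C₁ ─ X)
  minimal′ = fvs-delete C₁-fvs , λ Y → bound Y ∘ proj₂

  small : _≤fvs_ M ∣ C₁ ─ X ∣ (induced M (delete M (whole M) X) ((C₁ ─ X) ∪ (F₁ ─ X)))
  small Y (_ , acyclic) = bound Y (acyclic ∘ weaken-delete (certificate-delete H⊆))
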